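{- Let $G$ be a finite simple $2$-connected graph such that for every edge $e \in E(G)$ the graph $G \setminus e$ (obtained by deleting the edge $e$) is not bipartite. Then every edge of $G$ is contained in a cycle of even length.
   Context: Graphs are finite, simple (no loops, no multiple edges). A graph is $2$-connected if it has more than $2$ vertices and remains connected whenever fewer than $2$ vertices are removed. The length of a cycle is its number of edges. -}

module Defs where

open import Data.Nat using (ℕ; _<_; _≤_)
open import Data.Nat.Divisibility using (_∣_)
open import Data.Fin using (Fin; _≟_)
open import Data.Bool using (Bool; true; false; _∧_; _∨_; not)
open import Data.List using (List; []; _∷_; _++_; [_]; length)
open import Data.List.Relation.Unary.All using (All)
open import Data.List.Relation.Unary.Unique.Propositional using (Unique)
open import Data.Product using (Σ; ∃; ∃-syntax; _×_; _,_)
open import Data.Sum using (_⊎_)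
open import Data.Unit using (⊤)
open import Data.Empty using (⊥)
open import Relation.Nullary using (¬_)
open import Relation.Nullary.Decidable using (⌊_⌋)
open import Relation.Binary.PropositionalEquality using (_≡_; _≢_)

record Graph : Set where
  field
    n      : ℕ
    adj    : Fin n → Fin n → Bool
    sym    : ∀ u v → adj u v ≡ adj v u
    irrefl : ∀ u → adj u u ≡ false
open Graph public

Vertex : Graph → Set
Vertex G = Fin (n G)

ConsecAdj : (G : Graph) → List (Vertex G) → Set
ConsecAdj G []           = ⊤
ConsecAdj G (x ∷ [])     = ⊤
ConsecAdj G (x ∷ y ∷ r)  = adj G x y ≡ true × ConsecAdj G (y ∷ r)

-- u and v are joined by a walk in G all of whose vertices avoid the set X
-- (given as a predicate).  Equivalently: u, v are connected in G - X.
ConnectedAvoiding : (G : Graph) → (Vertex G → Set) → Vertex G → Vertex G → Set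
ConnectedAvoiding G X u v =
  u ≡ v ⊎ Σ (List (Vertex G)) λ ws →
    ConsecAdj G (u ∷ ws ++ [ v ]) × All (λ w → ¬ X w) (u ∷ ws ++ [ v ])

Connected : Graph → Set
Connected G = ∀ (u v : Vertex G) → ConnectedAvoiding G (λ _ → ⊥) u v

-- G is 2-connected: more than 2 vertices, and G - S is connected for every
-- set S of fewer than 2 vertices (i.e. S = ∅ or S = {x}).
TwoConnected : Graph → Set
TwoConnected G =
  2 < n G × Connected G ×
  (∀ (x u v : Vertex G) → u ≢ x → v ≢ x → ConnectedAvoiding G (λ w → w ≡ x) u v)

Bipartite : Graph → Set
Bipartite G = Σ (Vertex G → Bool) λ c →
  ∀ u v → adj G u v ≡ true → c u ≢ c v

deleteEdge : (G : Graph) → Vertex G → Vertex G → Graph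
deleteEdge G u v = record
  { n = n G
  ; adj = adj'
  ; sym = sym'
  ; irrefl = irr'
  }
  where
  isUV : Vertex G → Vertex G → Bool
  isUV a b = (⌊ a ≟ u ⌋ ∧ ⌊ b ≟ v ⌋) ∨ (⌊ a ≟ v ⌋ ∧ ⌊ b ≟ u ⌋)
  adj' : Vertex G → Vertex G → Bool
  adj' a b = adj G a b ∧ not (isUV a b)
  open import Data.Bool.Properties using (∨-comm)
  open import Relation.Binary.PropositionalEquality using (cong₂; trans)
  sym' : ∀ a b → adj' a b ≡ adj' b a
  sym' a b = cong₂ (λ p q → p ∧ not q) (sym G a b)
               (trans (∨-comm (⌊ a ≟ u ⌋ ∧ ⌊ b ≟ v ⌋) (⌊ a ≟ v ⌋ ∧ ⌊ b ≟ u ⌋)) swapped)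
    where
    open import Data.Bool.Properties using (∧-comm)
    swapped : ((⌊ a ≟ v ⌋ ∧ ⌊ b ≟ u ⌋) ∨ (⌊ a ≟ u ⌋ ∧ ⌊ b ≟ v ⌋))
              ≡ ((⌊ b ≟ u ⌋ ∧ ⌊ a ≟ v ⌋) ∨ (⌊ b ≟ v ⌋ ∧ ⌊ a ≟ u ⌋))
    swapped = cong₂ _∨_ (∧-comm ⌊ a ≟ v ⌋ ⌊ b ≟ u ⌋) (∧-comm ⌊ a ≟ u ⌋ ⌊ b ≟ v ⌋)
  irr' : ∀ a → adj' a a ≡ false
  irr' a rewrite irrefl G a = Relation.Binary.PropositionalEquality.refl

-- A cycle: a list of k ≥ 3 distinct vertices v₀ … v_{k-1} with v_i v_{i+1}
-- adjacent and v_{k-1} v₀ adjacent.  Its length (number of edges) is k.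
record Cycle (G : Graph) : Set where
  field
    start    : Vertex G
    rest     : List (Vertex G)
    distinct : Unique (start ∷ rest)
    long     : 3 ≤ length (start ∷ rest)
    closed   : ConsecAdj G (start ∷ rest ++ [ start ])
open Cycle public

cycleLength : ∀ {G} → Cycle G → ℕ
cycleLength C = length (start C ∷ rest C)

EdgeInCycle : ∀ {G} → Vertex G → Vertex G → Cycle G → Set
EdgeInCycle {G} u v C =
  ∃[ as ] ∃[ bs ]
    (start C ∷ rest C ++ [ start C ] ≡ as ++ u ∷ v ∷ bs
     ⊎ start C ∷ rest C ++ [ start C ] ≡ as ++ v ∷ u ∷ bs)

EvenCycle : ∀ {G} → Cycle G → Set
EvenCycle C = 2 ∣ cycleLength C

module Submission where

-- Since G is 2-connected, G − uv is connected, and it is not bipartite; colouring every vertex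
-- by the parity of a walk from a fixed root therefore fails on some edge, which yields an odd
-- closed walk and hence an odd cycle C of G − uv. A fan (Menger-type) argument in G gives
-- disjoint paths from u and from v to distinct vertices a, b of C, each meeting C only at its
-- end. The two arcs of C between a and b together have odd length, so exactly one of them
-- closes the path u ⋯ a ⋯ b ⋯ v into an even cycle with the edge vu.

open import Data.Bool using (Bool; true; false)
open import Data.Bool.Properties using (∧-zeroʳ)
import Data.Bool.Properties as Bool
open import Data.Empty using (⊥-elim)
open import Data.Fin as Fin using (Fin; _≟_)
open import Data.Fin.Properties using (all?; ¬∀⟶∃¬)
open import Data.List using (List; []; _∷_; _++_; [_]; length; reverse)
open import Data.List.Properties
  using (++-assoc; ++-identityʳ; length-++; length-++-sucʳ; length-reverse; unfold-reverse; reverse-++)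
open import Data.List.Membership.Propositional using (_∈_; _∉_)
open import Data.List.Membership.Propositional.Properties using (∈-++⁺ˡ; ∈-++⁺ʳ; ∈-++⁻; ∈-∃++)
open import Data.List.Membership.DecPropositional using (_∈?_)
open import Data.List.Relation.Binary.Disjoint.Propositional using (Disjoint)
open import Data.List.Relation.Binary.Permutation.Propositional using (_↭_; ↭-refl; ↭-sym; ↭⇒↭ₛ)
open import Data.List.Relation.Binary.Permutation.Propositional.Properties
  using (↭-reverse; ++-comm; ↭-length; ∈-resp-↭)
import Data.List.Relation.Binary.Permutation.Setoid.Properties as Permutation
open import Data.List.Relation.Binary.Subset.Propositional using (_⊆_)
open import Data.List.Relation.Unary.All using (All; []; _∷_)
import Data.List.Relation.Unary.All as All
open import Data.List.Relation.Unary.All.Properties using (¬Any⇒All¬)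
open import Data.List.Relation.Unary.Any using (here; there)
import Data.List.Relation.Unary.Any.Properties as Any
open import Data.List.Relation.Unary.Unique.Propositional using (Unique; []; _∷_)
import Data.List.Relation.Unary.Unique.Propositional.Properties as Unique
open import Data.Nat using (ℕ; zero; suc; _+_; _≤_; _<_; s≤s; z≤n; parity)
open import Data.Nat.Divisibility using (_∣_; divides)
open import Data.Nat.Induction using (<-wellFounded)
open import Data.Nat.Properties using (m<m+n; m<n+m; suc-injective)
open import Data.Nat.Tactic.RingSolver using (solve-∀)
open import Data.Parity.Base as ℙ using (Parity; 0ℙ; 1ℙ)
import Data.Parity.Properties as ℙ
open import Data.Product using (Σ; ∃-syntax; _×_; _,_; proj₁; proj₂; map₁; map₂)
import Data.Product as Product
open import Data.Sum using (_⊎_; inj₁; inj₂)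
open import Function using (id; _∘_; case_of_)
open import Induction.WellFounded using (Acc; acc)
open import Relation.Binary.PropositionalEquality
  using (_≡_; _≢_; refl; sym; trans; cong; cong₂; subst; setoid; module ≡-Reasoning)
open import Relation.Nullary using (¬_; Dec; yes; no; ¬?)
open import Relation.Nullary.Decidable using (_→-dec_; isYes)

open import Defs renaming (sym to adj-sym)

private variable
  N : ℕ
  V : Set
  x y z w : V
  xs ys : List V

unique-∷ : x ∉ xs → Unique xs → Unique (x ∷ xs)
unique-∷ x∉ u = ¬Any⇒All¬ _ x∉ ∷ u

unique-++⁻ : ∀ (xs : List V) → Unique (xs ++ ys) → Unique xs × Unique ys × Disjoint xs ys
unique-++⁻ []       u          = [] , u , λ ()
unique-++⁻ (x ∷ xs) (x∉ ∷ u) with unique-++⁻ xs u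
... | uxs , uys , xs#ys =
  unique-∷ (λ w∈xs → All.lookup x∉ (∈-++⁺ˡ w∈xs) refl) uxs , uys ,
  λ { (here refl , w∈ys)  → All.lookup x∉ (∈-++⁺ʳ xs w∈ys) refl
    ; (there w∈xs , w∈ys) → xs#ys (w∈xs , w∈ys) }

unique-resp-↭ : {V : Set} {xs ys : List V} → xs ↭ ys → Unique xs → Unique ys
unique-resp-↭ {V} xs↭ys = Permutation.Unique-resp-↭ (setoid V) (↭⇒↭ₛ xs↭ys)

unique-reverse : Unique xs → Unique (reverse xs)
unique-reverse {xs = xs} = unique-resp-↭ (↭-sym (↭-reverse xs))

unique⊎repeat : (l : List (Fin N)) → Unique l ⊎ ∃[ X ] ∃[ x ] ∃[ B ] ∃[ D ] l ≡ X ++ x ∷ B ++ x ∷ D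
unique⊎repeat []      = inj₁ []
unique⊎repeat (y ∷ l) with _∈?_ _≟_ y l | unique⊎repeat l
... | yes y∈l | _ with ∈-∃++ y∈l
...   | B , D , refl = inj₂ ([] , y , B , D , refl)
unique⊎repeat (y ∷ l) | no y∉l | inj₁ u                         = inj₁ (unique-∷ y∉l u)
unique⊎repeat (y ∷ l) | no y∉l | inj₂ (X , x , B , D , refl) = inj₂ (y ∷ X , x , B , D , refl)

length-∷ʳ : ∀ (xs : List V) x → length (xs ++ [ x ]) ≡ suc (length xs)
length-∷ʳ xs x = trans (length-++-sucʳ xs x []) (cong (suc ∘ length) (++-identityʳ xs))

length-repeat : ∀ (X : List V) x B D → length (X ++ x ∷ B ++ x ∷ D) ≡ length (x ∷ B) + length (X ++ x ∷ D)
length-repeat X x B D = begin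
  length (X ++ x ∷ B ++ x ∷ D)                 ≡⟨ length-++ X ⟩
  length X + suc (length (B ++ x ∷ D))         ≡⟨ cong (λ k → length X + suc k) (length-++ B) ⟩
  length X + suc (length B + suc (length D))   ≡⟨ rearrange (length X) (length B) (length D) ⟩
  suc (length B) + (length X + suc (length D)) ≡⟨ cong (suc (length B) +_) (sym (length-++ X)) ⟩
  length (x ∷ B) + length (X ++ x ∷ D)         ∎
  where
  open ≡-Reasoning
  rearrange : ∀ a b d → a + suc (b + suc d) ≡ suc b + (a + suc d)
  rearrange = solve-∀

length-repeat-< : ∀ (X : List V) x B D →
                  length (x ∷ B) < length (X ++ x ∷ B ++ x ∷ D) ×
                  length (X ++ x ∷ D) < length (X ++ x ∷ B ++ x ∷ D)
length-repeat-< X x B D rewrite length-repeat X x B D = m<m+n _ (0<length X) , m<n+m _ (s≤s z≤n)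
  where
  0<length : ∀ X → 0 < length (X ++ x ∷ D)
  0<length []      = s≤s z≤n
  0<length (_ ∷ _) = s≤s z≤n

parity-+-odd : ∀ m n → parity (m + n) ≡ 1ℙ → parity m ≡ 1ℙ ⊎ parity n ≡ 1ℙ
parity-+-odd m n odd rewrite ℙ.+-homo-+ m n with parity m
... | 1ℙ = inj₁ refl
... | 0ℙ = inj₂ odd

parity-suc-odd : ∀ m n → parity m ≡ parity (suc n) → parity (m + n) ≡ 1ℙ
parity-suc-odd m n same = begin
  parity (m + n)               ≡⟨ ℙ.+-homo-+ m n ⟩
  parity m ℙ.+ parity n        ≡⟨ cong (ℙ._+ parity n) same ⟩
  parity (suc n) ℙ.+ parity n  ≡⟨ cong (ℙ._+ parity n) (sym (ℙ.⁻¹-selfInverse (ℙ.suc-homo-⁻¹ n))) ⟩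
  parity n ℙ.⁻¹ ℙ.+ parity n   ≡⟨ ℙ.p⁻¹+p≡1ℙ (parity n) ⟩
  1ℙ                           ∎
  where open ≡-Reasoning

parity-choice : ∀ m n → parity (m + n) ≡ 1ℙ → ∀ k → parity (k + m) ≡ 0ℙ ⊎ parity (k + n) ≡ 0ℙ
parity-choice m n odd k rewrite ℙ.+-homo-+ k m | ℙ.+-homo-+ k n | ℙ.+-homo-+ m n
  with parity k | parity m | parity n
... | 0ℙ | 0ℙ | _  = inj₁ refl
... | 0ℙ | 1ℙ | 0ℙ = inj₂ refl
... | 1ℙ | 1ℙ | _  = inj₁ refl
... | 1ℙ | 0ℙ | 1ℙ = inj₂ refl

parity≡0ℙ⇒2∣ : ∀ n → parity n ≡ 0ℙ → 2 ∣ n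
parity≡0ℙ⇒2∣ zero          _    = divides 0 refl
parity≡0ℙ⇒2∣ (suc (suc n)) even with parity≡0ℙ⇒2∣ n even
... | divides q n≡q*2 = divides (suc q) (cong (suc ∘ suc) n≡q*2)

parityBit : Parity → Bool
parityBit 0ℙ = false
parityBit 1ℙ = true

parityBit-injective : ∀ {p q} → parityBit p ≡ parityBit q → p ≡ q
parityBit-injective {0ℙ} {0ℙ} _ = refl
parityBit-injective {1ℙ} {1ℙ} _ = refl

-- Walks

-- The index l lists the visited vertices in order, both ends included.
data Walk (A : Fin N → Fin N → Bool) : Fin N → Fin N → List (Fin N) → Set where
  done : ∀ x → Walk A x x [ x ]
  _◅_  : ∀ {x y z l} → A x y ≡ true → Walk A y z l → Walk A x z (x ∷ l)

infixr 5 _◅_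

module _ {A : Fin N → Fin N → Bool} where

  private variable
    l m : List (Fin N)

  infixr 5 _▸_

  walk-head : Walk A x y l → ∃[ t ] l ≡ x ∷ t
  walk-head (done x) = [] , refl
  walk-head (e ◅ w)  = _ , refl

  walk-last : Walk A x y l → ∃[ i ] l ≡ i ++ [ y ]
  walk-last (done x) = [] , refl
  walk-last (_◅_ {x = x} e w) with walk-last w
  ... | i , refl = x ∷ i , refl

  start∈ : Walk A x y l → x ∈ l
  start∈ (done x) = here refl
  start∈ (e ◅ w)  = here refl

  end∈ : Walk A x y l → y ∈ l
  end∈ (done x) = here refl
  end∈ (e ◅ w)  = there (end∈ w)

  _▸_ : Walk A x y l → Walk A y z (y ∷ m) → Walk A x z (l ++ m)
  done _  ▸ w′ = w′
  (e ◅ w) ▸ w′ = e ◅ (w ▸ w′)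

  splitAt : ∀ P {Q} → Walk A x z (P ++ y ∷ Q) → Walk A x y (P ++ [ y ]) × Walk A y z (y ∷ Q)
  splitAt []          (done _) = done _ , done _
  splitAt []          (e ◅ w)  = done _ , e ◅ w
  splitAt (_ ∷ [])    (e ◅ w)  = map₁ (e ◅_) (splitAt [] w)
  splitAt (_ ∷ p ∷ P) (e ◅ w)  = map₁ (e ◅_) (splitAt (p ∷ P) w)

  reverseWalk : (∀ a b → A a b ≡ A b a) → Walk A x y l → Walk A y x (reverse l)
  reverseWalk A-sym (done x) = done x
  reverseWalk A-sym (_◅_ {x} {y} {l = l} e w) =
    subst (Walk A _ _) (sym (unfold-reverse x l)) (reverseWalk A-sym w ▸ trans (A-sym y x) e ◅ done x)

  toPath : Walk A x z l → ∃[ l′ ] Walk A x z l′ × Unique l′ × l′ ⊆ l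
  toPath (done x) = [ x ] , done x , [] ∷ [] , id
  toPath (_◅_ {x} e w) with toPath w
  ... | m , w′ , um , m⊆ with _∈?_ _≟_ x m
  ...   | no x∉m =
    x ∷ m , e ◅ w′ , unique-∷ x∉m um , λ { (here refl) → here refl ; (there v∈) → there (m⊆ v∈) }
  ...   | yes x∈m with ∈-∃++ x∈m
  ...     | B , C , refl =
    x ∷ C , proj₂ (splitAt B w′) , proj₁ (proj₂ (unique-++⁻ B um)) ,
    λ v∈ → there (m⊆ (∈-++⁺ʳ B v∈))

  walk-length≥3 : x ≢ y → A x y ≡ false → Walk A x y l → 3 ≤ length l
  walk-length≥3 x≢y _   (done _)      = ⊥-elim (x≢y refl)
  walk-length≥3 _   ¬xy (xy ◅ done _) with trans (sym xy) ¬xy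
  ... | ()
  walk-length≥3 _   _   (_ ◅ _ ◅ w)   with walk-head w
  ... | _ , refl = s≤s (s≤s (s≤s z≤n))

  rotateAt : ∀ {s a} → Walk A s s (l ++ [ s ]) → a ∈ l →
             ∃[ R ] Walk A a a ((a ∷ R) ++ [ a ]) × l ↭ a ∷ R
  rotateAt {s = s} {a} w a∈l with ∈-∃++ a∈l
  ... | [] , Y , refl with walk-head w
  ...   | _ , refl = Y , w , ↭-refl
  rotateAt {s = s} {a} w a∈l | x ∷ X , Y , refl
    with splitAt (x ∷ X) (subst (Walk A s s) (++-assoc (x ∷ X) (a ∷ Y) [ s ]) w)
  ... | w₁ , w₂ with walk-head w₁
  ...   | _ , refl =
    Y ++ s ∷ X , subst (Walk A a a) (cong (a ∷_) reassoc) (w₂ ▸ w₁) , ++-comm (s ∷ X) (a ∷ Y)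
    where
    reassoc : (Y ++ [ s ]) ++ X ++ [ a ] ≡ (Y ++ s ∷ X) ++ [ a ]
    reassoc = trans (++-assoc Y [ s ] (X ++ [ a ])) (sym (++-assoc Y (s ∷ X) [ a ]))

module _ {A B : Fin N → Fin N → Bool} where

  mapWalk : (∀ {a b} → A a b ≡ true → B a b ≡ true) → ∀ {l} → Walk A x y l → Walk B x y l
  mapWalk f (done x) = done x
  mapWalk f (e ◅ w)  = f e ◅ mapWalk f w

  mapWalkWithin : (P : Fin N → Set) → (∀ {a b} → P a → P b → A a b ≡ true → B a b ≡ true) →
                  ∀ {l} → All P l → Walk A x y l → Walk B x y l
  mapWalkWithin P f _         (done x) = done x
  mapWalkWithin P f (pa ∷ ps) (e ◅ w)  = f pa (All.lookup ps (start∈ w)) e ◅ mapWalkWithin P f ps w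

module _ (G : Graph) where

  adj⇒≢ : adj G x y ≡ true → x ≢ y
  adj⇒≢ {x} e refl with trans (sym e) (irrefl G x)
  ... | ()

  adj-flip : adj G x y ≡ true → adj G y x ≡ true
  adj-flip {x} {y} e = trans (adj-sym G y x) e

  consecAdj⇒walk : ∀ x ws y → ConsecAdj G (x ∷ ws ++ [ y ]) → Walk (adj G) x y (x ∷ ws ++ [ y ])
  consecAdj⇒walk x []       y (e , _)  = e ◅ done y
  consecAdj⇒walk x (w ∷ ws) y (e , es) = e ◅ consecAdj⇒walk w ws y es

  walk⇒consecAdj : ∀ {l} → Walk (adj G) x y l → ConsecAdj G l
  walk⇒consecAdj (done x)         = _
  walk⇒consecAdj (e ◅ done _)     = e , _
  walk⇒consecAdj (e ◅ w@(_ ◅ _)) = e , walk⇒consecAdj w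

  connectedAvoiding⇒walk : (X : Vertex G → Set) → ¬ X x → ConnectedAvoiding G X x y →
                           ∃[ l ] Walk (adj G) x y l × All (¬_ ∘ X) l
  connectedAvoiding⇒walk X x∉X (inj₁ refl)                = _ , done _ , x∉X ∷ []
  connectedAvoiding⇒walk X x∉X (inj₂ (ws , es , avoids)) = _ , consecAdj⇒walk _ ws _ es , avoids

  evenCycleThrough : ∀ {u v t} → Walk (adj G) u v (u ∷ t) → Unique (u ∷ t) → 3 ≤ length (u ∷ t) →
                     adj G v u ≡ true → parity (length (u ∷ t)) ≡ 0ℙ →
                     Σ (Cycle G) λ C → EvenCycle C × EdgeInCycle u v C
  evenCycleThrough {u} {v} {t} w distinct long vu even with walk-last w
  ... | i , ut≡iv =
    record { start = u ; rest = t ; distinct = distinct ; long = long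
           ; closed = walk⇒consecAdj (w ▸ vu ◅ done u) } ,
    parity≡0ℙ⇒2∣ _ even ,
    i , [] , inj₂ (trans (cong (_++ [ u ]) ut≡iv) (++-assoc i [ v ] [ u ]))

module _ (G : Graph) (tc : TwoConnected G) where

  connectedWalk : ∀ x y → ∃[ l ] Walk (adj G) x y l
  connectedWalk x y = map₂ proj₁ (connectedAvoiding⇒walk G _ (λ ()) (proj₁ (proj₂ tc) x y))

  walkAvoiding : x ≢ y → w ≢ y → ∃[ l ] Walk (adj G) x w l × All (_≢ y) l
  walkAvoiding {x} {y} {w} x≢y w≢y = connectedAvoiding⇒walk G _ x≢y (proj₂ (proj₂ tc) y x w x≢y w≢y)

module _ (G : Graph) (u v : Vertex G) where

  private
    G′ = deleteEdge G u v

  deleteEdge-⊆ : adj G′ x y ≡ true → adj G x y ≡ true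
  deleteEdge-⊆ {x} {y} e with adj G x y
  ... | true  = refl
  ... | false = e

  deleteEdge-removes : adj G′ u v ≡ false
  deleteEdge-removes with u ≟ u | v ≟ v
  ... | yes _  | yes _  = ∧-zeroʳ (adj G u v)
  ... | no u≢u | _      = ⊥-elim (u≢u refl)
  ... | _      | no v≢v = ⊥-elim (v≢v refl)

  deleteEdge-keeps-≢v : x ≢ v → y ≢ v → adj G x y ≡ true → adj G′ x y ≡ true
  deleteEdge-keeps-≢v {x} {y} x≢v y≢v e with x ≟ v | y ≟ v
  ... | yes x≡v | _       = ⊥-elim (x≢v x≡v)
  ... | _       | yes y≡v = ⊥-elim (y≢v y≡v)
  ... | no _    | no _ rewrite ∧-zeroʳ (isYes (x ≟ u)) | e = refl

  deleteEdge-keeps-≢u : x ≢ u → y ≢ u → adj G x y ≡ true → adj G′ x y ≡ true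
  deleteEdge-keeps-≢u {x} {y} x≢u y≢u e with x ≟ u | y ≟ u
  ... | yes x≡u | _       = ⊥-elim (x≢u x≡u)
  ... | _       | yes y≡u = ⊥-elim (y≢u y≡u)
  ... | no _    | no _ rewrite ∧-zeroʳ (isYes (x ≟ v)) | e = refl

-- Odd cycles

record OddCycle (A : Fin N → Fin N → Bool) : Set where
  field
    base        : Fin N
    ring        : List (Fin N)
    loop        : Walk A base base (ring ++ [ base ])
    ring-unique : Unique ring
    ring-odd    : parity (length ring) ≡ 1ℙ

open OddCycle

module _ {A : Fin N → Fin N → Bool} where

  splitAtRepeat : ∀ X {x B D s} → Walk A s s ((X ++ x ∷ B ++ x ∷ D) ++ [ s ]) →
                  Walk A x x ((x ∷ B) ++ [ x ]) × Walk A s s ((X ++ x ∷ D) ++ [ s ])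
  splitAtRepeat X {x} {B} {D} {s} w
    with splitAt X (subst (Walk A s s) (++-assoc X (x ∷ B ++ x ∷ D) [ s ]) w)
  ... | w₁ , w₂ with splitAt (x ∷ B) (subst (Walk A x s) (cong (x ∷_) (++-assoc B (x ∷ D) [ s ])) w₂)
  ...   | inner , w₃ =
    inner , subst (Walk A s s) (trans (++-assoc X [ x ] _) (sym (++-assoc X (x ∷ D) [ s ]))) (w₁ ▸ w₃)

  -- Cutting an odd closed walk at a repeated vertex leaves two shorter closed walks, one of them odd.
  oddClosedWalk⇒oddCycle : ∀ {s} l → Walk A s s (l ++ [ s ]) → parity (length l) ≡ 1ℙ → OddCycle A
  oddClosedWalk⇒oddCycle l = go l (<-wellFounded (length l))
    where
    go : ∀ {s} l → Acc _<_ (length l) → Walk A s s (l ++ [ s ]) → parity (length l) ≡ 1ℙ → OddCycle A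
    go l (acc shorter) w odd with unique⊎repeat l
    ... | inj₁ u = record { base = _ ; ring = l ; loop = w ; ring-unique = u ; ring-odd = odd }
    ... | inj₂ (X , x , B , D , refl)
      with splitAtRepeat X w
         | parity-+-odd (length (x ∷ B)) (length (X ++ x ∷ D))
             (subst (λ k → parity k ≡ 1ℙ) (length-repeat X x B D) odd)
    ...   | inner , _ | inj₁ odd-inner =
      go (x ∷ B) (shorter (proj₁ (length-repeat-< X x B D))) inner odd-inner
    ...   | _ , outer | inj₂ odd-outer =
      go (X ++ x ∷ D) (shorter (proj₂ (length-repeat-< X x B D))) outer odd-outer

module _ (H : Graph) where

  twoVerticesOnRing : (C : OddCycle (adj H)) →
                      ∃[ t₁ ] ∃[ t₂ ] t₁ ∈ ring C × t₂ ∈ ring C × t₁ ≢ t₂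
  twoVerticesOnRing C = go (ring C) (loop C) (ring-unique C) (ring-odd C)
    where
    go : ∀ {s} l → Walk (adj H) s s (l ++ [ s ]) → Unique l → parity (length l) ≡ 1ℙ →
         ∃[ t₁ ] ∃[ t₂ ] t₁ ∈ l × t₂ ∈ l × t₁ ≢ t₂
    go []          _            _        ()
    go (_ ∷ [])    (e ◅ done _) _        _ = ⊥-elim (adj⇒≢ H e refl)
    go (x ∷ y ∷ _) _            (x∉ ∷ _) _ = x , y , here refl , there (here refl) , All.lookup x∉ (here refl)

  private
    properEdge? : (c : Vertex H → Bool) → ∀ x y → Dec (adj H x y ≡ true → c x ≢ c y)
    properEdge? c x y = (adj H x y Bool.≟ true) →-dec ¬? (c x Bool.≟ c y)

  monochromaticEdge : ¬ Bipartite H → (c : Vertex H → Bool) → ∃[ x ] ∃[ y ] adj H x y ≡ true × c x ≡ c y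
  monochromaticEdge nonBip c with all? (λ x → all? (properEdge? c x))
  ... | yes proper = ⊥-elim (nonBip (c , proper))
  ... | no improper with ¬∀⟶∃¬ _ _ (λ x → all? (properEdge? c x)) improper
  ...   | x , improperAt-x with ¬∀⟶∃¬ _ _ (properEdge? c x) improperAt-x
  ...     | y , improperAt-xy with adj H x y Bool.≟ true | c x Bool.≟ c y
  ...       | yes e | yes same  = x , y , e , same
  ...       | no ¬e | _         = ⊥-elim (improperAt-xy (⊥-elim ∘ ¬e))
  ...       | yes _ | no differ = ⊥-elim (improperAt-xy (λ _ → differ))

  oddClosedWalk : ∀ r → (∀ w → ∃[ l ] Walk (adj H) r w l) → ¬ Bipartite H →
                  ∃[ l ] Walk (adj H) r r (l ++ [ r ]) × parity (length l) ≡ 1ℙ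
  oddClosedWalk r reach nonBip
    with monochromaticEdge nonBip (λ w → parityBit (parity (length (proj₁ (reach w)))))
  ... | x , y , e , same with reach x | reach y
  ...   | lx , wx | ly , wy with walk-last (reverseWalk (adj-sym H) wy)
  ...     | i , rev≡ = lx ++ i , around , odd
    where
    around : Walk (adj H) r r ((lx ++ i) ++ [ r ])
    around = subst (Walk (adj H) r r) (sym (++-assoc lx i [ r ]))
               (wx ▸ e ◅ subst (Walk (adj H) y r) rev≡ (reverseWalk (adj-sym H) wy))

    |ly|≡ : length ly ≡ suc (length i)
    |ly|≡ = trans (sym (length-reverse ly)) (trans (cong length rev≡) (length-∷ʳ i r))

    odd : parity (length (lx ++ i)) ≡ 1ℙ
    odd = subst (λ k → parity k ≡ 1ℙ) (sym (length-++ lx))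
            (parity-suc-odd (length lx) (length i) (trans (parityBit-injective same) (cong parity |ly|≡)))

record Arc (A : Fin N → Fin N → Bool) (cyc : List (Fin N)) (a b : Fin N) : Set where
  field
    interior    : List (Fin N)
    path        : Walk A a b (a ∷ interior)
    path-unique : Unique (a ∷ interior)
    path-⊆      : a ∷ interior ⊆ cyc

open Arc

module _ {A : Fin N → Fin N → Bool} where

  private variable
    a b : Fin N
    cyc cyc′ : List (Fin N)

  Arc-⊆ : cyc ⊆ cyc′ → Arc A cyc a b → Arc A cyc′ a b
  Arc-⊆ ⊆cyc′ α = record
    { interior = interior α ; path = path α ; path-unique = path-unique α ; path-⊆ = ⊆cyc′ ∘ path-⊆ α }

  arcsOfRootedCycle : (∀ x y → A x y ≡ A y x) → ∀ {R} → Walk A a a ((a ∷ R) ++ [ a ]) → Unique (a ∷ R) → b ∈ R →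
                      Σ (Arc A (a ∷ R) a b) λ α → Σ (Arc A (a ∷ R) a b) λ β →
                        length (interior α) + length (interior β) ≡ length (a ∷ R)
  arcsOfRootedCycle {a} {b} A-sym w u b∈R with ∈-∃++ b∈R
  ... | K₁ , K₂ , refl
    with splitAt (a ∷ K₁) (subst (Walk A a a) (cong (a ∷_) (++-assoc K₁ (b ∷ K₂) [ a ])) w)
  ...   | forth , back = α , β , lengths
    where
    α : Arc A (a ∷ K₁ ++ b ∷ K₂) a b
    α = record
      { interior = K₁ ++ [ b ] ; path = forth
      ; path-unique = proj₁ (unique-++⁻ ((a ∷ K₁) ++ [ b ])
                        (subst Unique (sym (++-assoc (a ∷ K₁) [ b ] K₂)) u))
      ; path-⊆ = λ {v} v∈ → subst (v ∈_) (++-assoc (a ∷ K₁) [ b ] K₂) (∈-++⁺ˡ v∈) }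

    back-unique : Unique ((b ∷ K₂) ++ [ a ])
    back-unique = proj₁ (unique-++⁻ ((b ∷ K₂) ++ [ a ])
      (subst Unique (sym (++-assoc (b ∷ K₂) [ a ] K₁)) (unique-resp-↭ (++-comm (a ∷ K₁) (b ∷ K₂)) u)))

    β : Arc A (a ∷ K₁ ++ b ∷ K₂) a b
    β = record
      { interior = reverse (b ∷ K₂)
      ; path = subst (Walk A a b) (reverse-++ (b ∷ K₂) [ a ]) (reverseWalk A-sym back)
      ; path-unique = subst Unique (reverse-++ (b ∷ K₂) [ a ]) (unique-reverse back-unique)
      ; path-⊆ = λ { (here refl) → here refl ; (there v∈) → there (∈-++⁺ʳ K₁ (Any.reverse⁻ v∈)) } }

    lengths : length (K₁ ++ [ b ]) + length (reverse (b ∷ K₂)) ≡ length (a ∷ K₁ ++ b ∷ K₂)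
    lengths = trans (cong₂ _+_ (length-∷ʳ K₁ b) (length-reverse (b ∷ K₂))) (cong suc (sym (length-++ K₁)))

  arcsBetween : (∀ x y → A x y ≡ A y x) → (C : OddCycle A) → a ∈ ring C → b ∈ ring C → a ≢ b →
                Σ (Arc A (ring C) a b) λ α → Σ (Arc A (ring C) a b) λ β →
                  parity (length (interior α) + length (interior β)) ≡ 1ℙ
  arcsBetween {a = a} A-sym C a∈ b∈ a≢b with rotateAt (loop C) a∈
  ... | R , w , ring↭ with ∈-resp-↭ ring↭ b∈
  ...   | here b≡a  = ⊥-elim (a≢b (sym b≡a))
  ...   | there b∈R with arcsOfRootedCycle A-sym w (unique-resp-↭ ring↭ (ring-unique C)) b∈R
  ...     | α , β , lengths =
    Arc-⊆ onRing α , Arc-⊆ onRing β ,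
    subst (λ k → parity k ≡ 1ℙ) (trans (↭-length ring↭) (sym lengths)) (ring-odd C)
    where
    onRing : a ∷ R ⊆ ring C
    onRing = ∈-resp-↭ (↭-sym ring↭)

module Routes (G : Graph) where

  record Route (T : List (Vertex G)) (z : Vertex G) : Set where
    constructor mkRoute
    field
      tail           : List (Vertex G)
      end            : Vertex G
      walk           : Walk (adj G) z end (z ∷ tail)
      end∈T          : end ∈ T
      meets-T-at-end : ∀ {w} → w ∈ z ∷ tail → w ∈ T → w ≡ end
      unique         : Unique (z ∷ tail)

    vertices : List (Vertex G)
    vertices = z ∷ tail

  open Route public

  private variable
    S T : List (Vertex G)
    l : List (Vertex G)

  trivialRoute : z ∈ T → Route T z
  trivialRoute {z} z∈T = record
    { tail = [] ; end = z ; walk = done z ; end∈T = z∈T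
    ; meets-T-at-end = λ { (here refl) _ → refl } ; unique = [] ∷ [] }

  extendRoute : adj G x y ≡ true → x ∉ T → (R : Route T y) → x ∉ vertices R → Route T x
  extendRoute e x∉T R x∉R = record
    { tail = vertices R ; end = end R ; walk = e ◅ walk R ; end∈T = end∈T R
    ; meets-T-at-end = λ { (here refl) x∈T → ⊥-elim (x∉T x∈T) ; (there w∈R) → meets-T-at-end R w∈R }
    ; unique = unique-∷ x∉R (unique R) }

  narrowRoute : S ⊆ T → (R : Route T z) → end R ∈ S → Route S z
  narrowRoute S⊆T R end∈S = record
    { tail = tail R ; end = end R ; walk = walk R ; end∈T = end∈S
    ; meets-T-at-end = λ w∈R w∈S → meets-T-at-end R w∈R (S⊆T w∈S) ; unique = unique R }

  firstHit : ∀ T → Walk (adj G) x z l → z ∈ T → Unique l → Σ (Route T x) λ R → vertices R ⊆ l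
  firstHit T (done x) z∈T _ = trivialRoute z∈T , id
  firstHit T (_◅_ {x} e w) z∈T (x∉ ∷ u) with _∈?_ _≟_ x T
  ... | yes x∈T = trivialRoute x∈T , λ { (here refl) → here refl }
  ... | no x∉T with firstHit T w z∈T u
  ...   | R , R⊆l =
    extendRoute e x∉T R (λ x∈R → All.lookup x∉ (R⊆l x∈R) refl) ,
    λ { (here refl) → here refl ; (there w∈R) → there (R⊆l w∈R) }

  route : ∀ T → Walk (adj G) x z l → z ∈ T → Σ (Route T x) λ R → vertices R ⊆ l
  route T w z∈T with toPath w
  ... | l′ , w′ , u′ , l′⊆l with firstHit T w′ z∈T u′
  ...   | R , R⊆l′ = R , l′⊆l ∘ R⊆l′

  suffixRoute : (R : Route T x) → y ∈ tail R →
                Σ (Route T y) λ R′ → vertices R′ ⊆ tail R × end R′ ≡ end R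
  suffixRoute (mkRoute t a w a∈T meets u) y∈ with ∈-∃++ y∈
  ... | X , Y , refl =
    mkRoute Y a (proj₂ (splitAt (_ ∷ X) w)) a∈T (λ w∈ → meets (there (∈-++⁺ʳ X w∈)))
            (proj₁ (proj₂ (unique-++⁻ (_ ∷ X) u))) ,
    ∈-++⁺ʳ X , refl

  joinRoutes : T ⊆ S → (Q : Route S z) (R : Route T (end Q)) → tail R ⊆ S → Route T z
  joinRoutes {T} {z = z} T⊆S (mkRoute tq y wq _ meetsQ uq) (mkRoute tr a wr a∈T meetsR ur) tr⊆S =
    mkRoute (tq ++ tr) a (wq ▸ wr) a∈T meets
            (Unique.++⁺ uq (Unique.drop⁺ 1 ur) λ (w∈Q , w∈tr) →
              Unique.Unique[x∷xs]⇒x∉xs ur (subst (_∈ tr) (meetsQ w∈Q (tr⊆S w∈tr)) w∈tr))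
    where
    meets : ∀ {w} → w ∈ (z ∷ tq) ++ tr → w ∈ T → w ≡ a
    meets w∈ w∈T with ∈-++⁻ (z ∷ tq) w∈
    ... | inj₂ w∈tr = meetsR (there w∈tr) w∈T
    ... | inj₁ w∈Q with meetsQ w∈Q (T⊆S w∈T)
    ...   | refl = meetsR (here refl) w∈T

-- Disjoint routes in a 2-connected graph

module TwoConnectedRoutes (G : Graph) (tc : TwoConnected G)
                          (T : List (Vertex G)) {t₁ t₂ : Vertex G}
                          (t₁∈T : t₁ ∈ T) (t₂∈T : t₂ ∈ T) (t₁≢t₂ : t₁ ≢ t₂) where
  open Routes G

  record Fan (z : Vertex G) : Set where
    field
      left right  : Route T z
      ends-differ : end left ≢ end right
      disjoint    : Disjoint (tail left) (tail right)

    swap : Fan z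
    swap = record { left = right ; right = left ; ends-differ = ends-differ ∘ sym
                  ; disjoint = λ (w∈r , w∈l) → disjoint (w∈l , w∈r) }

    start∉T : z ∉ T
    start∉T z∈T =
      ends-differ (trans (sym (meets-T-at-end left (here refl) z∈T)) (meets-T-at-end right (here refl) z∈T))

  record DisjointRoutes (u v : Vertex G) : Set where
    field
      fromU       : Route T u
      fromV       : Route T v
      ends-differ : end fromU ≢ end fromV
      disjoint    : Disjoint (vertices fromU) (vertices fromV)

    swap : DisjointRoutes v u
    swap = record { fromU = fromV ; fromV = fromU ; ends-differ = ends-differ ∘ sym
                  ; disjoint = λ (w∈v , w∈u) → disjoint (w∈u , w∈v) }

  open Fan hiding (swap)
  open DisjointRoutes hiding (swap)

  private variable
    S : List (Vertex G)
    p u v : Vertex G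

  another∈T : ∀ y → ∃[ t ] t ∈ T × t ≢ y
  another∈T y with t₁ ≟ y
  ... | yes refl = t₂ , t₂∈T , t₁≢t₂ ∘ sym
  ... | no t₁≢y  = t₁ , t₁∈T , t₁≢y

  routeAvoiding : ∀ S {t} → t ∈ S → z ≢ y → t ≢ y → Σ (Route S z) λ R → y ∉ vertices R
  routeAvoiding S t∈S z≢y t≢y with walkAvoiding G tc z≢y t≢y
  ... | l , w , avoids-y with route S w t∈S
  ...   | R , R⊆l = R , λ y∈R → All.lookup avoids-y (R⊆l y∈R) refl

  ∈T⇒disjointRoutes : y ∈ T → z ≢ y → DisjointRoutes z y
  ∈T⇒disjointRoutes {y} y∈T z≢y with another∈T y
  ... | t , t∈T , t≢y with routeAvoiding T t∈T z≢y t≢y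
  ...   | R , y∉R = record
    { fromU = R ; fromV = trivialRoute y∈T
    ; ends-differ = λ end≡y → y∉R (subst (_∈ vertices R) end≡y (end∈ (walk R)))
    ; disjoint = λ { (w∈R , here refl) → y∉R w∈R } }

  disjointRoutes⇒fan : adj G z p ≡ true → z ∉ T → DisjointRoutes z p → Fan z
  disjointRoutes⇒fan e z∉T D = record
    { left = fromU D
    ; right = extendRoute e z∉T (fromV D) (λ z∈ → disjoint D (here refl , z∈))
    ; ends-differ = ends-differ D
    ; disjoint = λ (w∈l , w∈r) → disjoint D (there w∈l , w∈r) }

  spliceLeft : (F : Fan p) (Q : Route S z) →
               T ⊆ S → tail (left F) ⊆ S → tail (right F) ⊆ S →
               p ∉ vertices Q → end Q ∈ tail (left F) → DisjointRoutes z p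
  spliceLeft F Q T⊆S M₁⊆S M₂⊆S p∉Q y∈M₁ with suffixRoute (left F) y∈M₁
  ... | R , R⊆M₁ , endR≡ = record
    { fromU = joinRoutes T⊆S Q R (M₁⊆S ∘ R⊆M₁ ∘ there)
    ; fromV = right F
    ; ends-differ = ends-differ F ∘ trans (sym endR≡)
    ; disjoint = disjoint′ }
    where
    M₁#right : ∀ {w} → w ∈ tail (left F) → w ∉ vertices (right F)
    M₁#right w∈M₁ (here refl)  = Unique.Unique[x∷xs]⇒x∉xs (unique (left F)) w∈M₁
    M₁#right w∈M₁ (there w∈M₂) = disjoint F (w∈M₁ , w∈M₂)

    disjoint′ : Disjoint (vertices Q ++ tail R) (vertices (right F))
    disjoint′ (w∈ , w∈right) with ∈-++⁻ (vertices Q) w∈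
    ... | inj₂ w∈R = M₁#right (R⊆M₁ (there w∈R)) w∈right
    ... | inj₁ w∈Q with w∈right
    ...   | here refl  = p∉Q w∈Q
    ...   | there w∈M₂ with meets-T-at-end Q w∈Q (M₂⊆S w∈M₂)
    ...     | refl = disjoint F (y∈M₁ , w∈M₂)

  -- Route z, avoiding p, to the first vertex y of T or of the fan: if y lies on a branch, splice
  -- the route into that branch; otherwise y ∈ T and the route itself replaces the left branch.
  extendFan : Fan p → adj G z p ≡ true → z ∉ T → DisjointRoutes z p
  extendFan {p} {z} F e z∉T
    with routeAvoiding (T ++ tail (left F) ++ tail (right F)) (∈-++⁺ˡ (end∈T (left F)))
                       (adj⇒≢ G e) (λ { refl → start∉T F (end∈T (left F)) })
  ... | Q , p∉Q with _∈?_ _≟_ (end Q) (tail (left F)) | _∈?_ _≟_ (end Q) (tail (right F))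
  ...   | yes y∈M₁ | _        =
    spliceLeft F Q ∈-++⁺ˡ (∈-++⁺ʳ T ∘ ∈-++⁺ˡ) (∈-++⁺ʳ T ∘ ∈-++⁺ʳ _) p∉Q y∈M₁
  ...   | no _     | yes y∈M₂ =
    spliceLeft (Fan.swap F) Q ∈-++⁺ˡ (∈-++⁺ʳ T ∘ ∈-++⁺ʳ _) (∈-++⁺ʳ T ∘ ∈-++⁺ˡ) p∉Q y∈M₂
  ...   | no y∉M₁  | no y∉M₂  = record
    { fromU = narrowRoute ∈-++⁺ˡ Q y∈T
    ; fromV = right F
    ; ends-differ = λ { refl → y∉right (end∈ (walk (right F))) }
    ; disjoint = λ { (w∈Q , here refl)   → p∉Q w∈Q
                   ; (w∈Q , there w∈M₂) → y∉right (there (subst (_∈ _) (w≡y w∈Q w∈M₂) w∈M₂)) } }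
    where
    y∈T : end Q ∈ T
    y∈T with ∈-++⁻ T (end∈T Q)
    ... | inj₁ y∈T = y∈T
    ... | inj₂ y∈M with ∈-++⁻ (tail (left F)) y∈M
    ...   | inj₁ y∈M₁ = ⊥-elim (y∉M₁ y∈M₁)
    ...   | inj₂ y∈M₂ = ⊥-elim (y∉M₂ y∈M₂)

    w≡y : ∀ {w} → w ∈ vertices Q → w ∈ tail (right F) → w ≡ end Q
    w≡y w∈Q w∈M₂ = meets-T-at-end Q w∈Q (∈-++⁺ʳ T (∈-++⁺ʳ _ w∈M₂))

    y∉right : end Q ∉ vertices (right F)
    y∉right (here refl)  = start∉T F y∈T
    y∉right (there y∈M₂) = y∉M₂ y∈M₂

  fan : z ∉ T → Fan z
  fan {z} z∉T = fanAlong (proj₂ (connectedWalk G tc z t₁)) z∉T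
    where
    fanAlong : ∀ {x l} → Walk (adj G) x t₁ l → x ∉ T → Fan x
    fanAlong (done _) x∉T = ⊥-elim (x∉T t₁∈T)
    fanAlong (_◅_ {y = p} e w) x∉T with _∈?_ _≟_ p T
    ... | yes p∈T = disjointRoutes⇒fan e x∉T (∈T⇒disjointRoutes p∈T (adj⇒≢ G e))
    ... | no p∉T  = disjointRoutes⇒fan e x∉T (extendFan (fanAlong w p∉T) e x∉T)

  edge⇒disjointRoutes : adj G u v ≡ true → DisjointRoutes u v
  edge⇒disjointRoutes {u} {v} e with _∈?_ _≟_ u T | _∈?_ _≟_ v T
  ... | yes u∈T | yes v∈T = record
    { fromU = trivialRoute u∈T ; fromV = trivialRoute v∈T ; ends-differ = adj⇒≢ G e
    ; disjoint = λ { (here refl , here refl) → adj⇒≢ G e refl } }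
  ... | yes u∈T | no _    = DisjointRoutes.swap (∈T⇒disjointRoutes u∈T (adj⇒≢ G e ∘ sym))
  ... | no _    | yes v∈T = ∈T⇒disjointRoutes v∈T (adj⇒≢ G e)
  ... | no u∉T  | no v∉T  = DisjointRoutes.swap (extendFan (fan u∉T) (adj-flip G e) v∉T)

-- The graph G − uv and the even cycle

private
  besidesZero : ∀ {k} (w : Fin (suc (suc (suc k)))) → ∃[ r ] r ≢ Fin.zero × r ≢ w
  besidesZero w with w ≟ Fin.suc Fin.zero
  ... | yes refl = Fin.suc (Fin.suc Fin.zero) , (λ ()) , (λ ())
  ... | no w≢1   = Fin.suc Fin.zero , (λ ()) , w≢1 ∘ sym

thirdVertex : 2 < N → (u v : Fin N) → ∃[ r ] r ≢ u × r ≢ v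
thirdVertex (s≤s (s≤s (s≤s _))) u v with u ≟ Fin.zero | v ≟ Fin.zero
... | yes refl | _        = besidesZero v
... | no _     | yes refl = map₂ Product.swap (besidesZero u)
... | no u≢0   | no v≢0   = Fin.zero , u≢0 ∘ sym , v≢0 ∘ sym

module _ (G : Graph) (tc : TwoConnected G) {u v : Vertex G} (e : adj G u v ≡ true) where

  private
    G′ = deleteEdge G u v

  reachableAfterDeletion : ∃[ r ] ∀ w → ∃[ l ] Walk (adj G′) r w l
  reachableAfterDeletion with thirdVertex (proj₁ tc) u v
  ... | r , r≢u , r≢v = r , reach
    where
    reach : ∀ w → ∃[ l ] Walk (adj G′) r w l
    reach w with w ≟ v
    ... | yes refl with walkAvoiding G tc r≢u (adj⇒≢ G e ∘ sym)
    ...   | l , walk , avoids-u = l , mapWalkWithin (_≢ u) (deleteEdge-keeps-≢u G u v) avoids-u walk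
    reach w | no w≢v with walkAvoiding G tc r≢v w≢v
    ...   | l , walk , avoids-v = l , mapWalkWithin (_≢ v) (deleteEdge-keeps-≢v G u v) avoids-v walk

  oddCycleAfterDeletion : ¬ Bipartite G′ → OddCycle (adj G′)
  oddCycleAfterDeletion nonBip with reachableAfterDeletion
  ... | r , reach with oddClosedWalk G′ r reach nonBip
  ...   | l , w , odd = oddClosedWalk⇒oddCycle l w odd

  module _ (T : List (Vertex G)) {t₁ t₂ : Vertex G}
           (t₁∈T : t₁ ∈ T) (t₂∈T : t₂ ∈ T) (t₁≢t₂ : t₁ ≢ t₂) where
    open Routes G
    open TwoConnectedRoutes G tc T t₁∈T t₂∈T t₁≢t₂
    open DisjointRoutes hiding (swap)

    private
      fromU-in-G′ : (D : DisjointRoutes u v) → Walk (adj G′) u (end (fromU D)) (vertices (fromU D))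
      fromU-in-G′ D = mapWalkWithin (_≢ v) (deleteEdge-keeps-≢v G u v)
                        (All.tabulate λ w∈ w≡v → disjoint D (w∈ , here w≡v)) (walk (fromU D))

      toV-in-G′ : (D : DisjointRoutes u v) → Walk (adj G′) (end (fromV D)) v (reverse (vertices (fromV D)))
      toV-in-G′ D = reverseWalk (adj-sym G′) (mapWalkWithin (_≢ u) (deleteEdge-keeps-≢u G u v)
                      (All.tabulate λ w∈ w≡u → disjoint D (here w≡u , w∈)) (walk (fromV D)))

    -- The u–v path lies in G − uv, so it is not the single edge uv and the cycle has length ≥ 3.
    cycleThroughArc : (D : DisjointRoutes u v) (α : Arc (adj G′) T (end (fromU D)) (end (fromV D))) →
                      parity (length (vertices (fromU D)) + length (tail (fromV D)) + length (interior α)) ≡ 0ℙ →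
                      Σ (Cycle G) λ C → EvenCycle C × EdgeInCycle u v C
    cycleThroughArc D α even with walk-head (toV-in-G′ D)
    ... | m , rev≡ =
      evenCycleThrough G (mapWalk (deleteEdge-⊆ G u v) full) full-unique
        (walk-length≥3 (adj⇒≢ G e) (deleteEdge-removes G u v) full) (adj-flip G e)
        (subst (λ k → parity k ≡ 0ℙ) (sym full-length) even)
      where
      U = vertices (fromU D)
      K = interior α
      b = end (fromV D)

      full : Walk (adj G′) u v ((U ++ K) ++ m)
      full = (fromU-in-G′ D ▸ path α) ▸ subst (Walk (adj G′) b v) rev≡ (toV-in-G′ D)

      bm-unique : Unique (b ∷ m)
      bm-unique = subst Unique rev≡ (unique-reverse (unique (fromV D)))

      m⊆V : m ⊆ vertices (fromV D)
      m⊆V w∈m = Any.reverse⁻ (subst (_ ∈_) (sym rev≡) (there w∈m))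

      UK-unique : Unique (U ++ K)
      UK-unique = Unique.++⁺ (unique (fromU D)) (Unique.drop⁺ 1 (path-unique α)) λ (w∈U , w∈K) →
        Unique.Unique[x∷xs]⇒x∉xs (path-unique α)
          (subst (_∈ K) (meets-T-at-end (fromU D) w∈U (path-⊆ α (there w∈K))) w∈K)

      full-unique : Unique ((U ++ K) ++ m)
      full-unique = Unique.++⁺ UK-unique (Unique.drop⁺ 1 bm-unique) λ (w∈UK , w∈m) →
        case ∈-++⁻ U w∈UK of λ where
          (inj₁ w∈U) → disjoint D (w∈U , m⊆V w∈m)
          (inj₂ w∈K) → Unique.Unique[x∷xs]⇒x∉xs bm-unique
                         (subst (_∈ m) (meets-T-at-end (fromV D) (m⊆V w∈m) (path-⊆ α (there w∈K))) w∈m)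

      full-length : length ((U ++ K) ++ m) ≡ length U + length (tail (fromV D)) + length K
      full-length = begin
        length ((U ++ K) ++ m)                         ≡⟨ length-++ (U ++ K) ⟩
        length (U ++ K) + length m                     ≡⟨ cong₂ _+_ (length-++ U) |m|≡ ⟩
        length U + length K + length (tail (fromV D))  ≡⟨ swap-last (length U) (length K) _ ⟩
        length U + length (tail (fromV D)) + length K  ∎
        where
        open ≡-Reasoning
        |m|≡ : length m ≡ length (tail (fromV D))
        |m|≡ = suc-injective (trans (cong length (sym rev≡)) (length-reverse (vertices (fromV D))))
        swap-last : ∀ a b c → a + b + c ≡ a + c + b
        swap-last = solve-∀

  evenCycleThroughEdge : OddCycle (adj G′) → Σ (Cycle G) λ C → EvenCycle C × EdgeInCycle u v C
  evenCycleThroughEdge C with twoVerticesOnRing G′ C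
  ... | t₁ , t₂ , t₁∈ , t₂∈ , t₁≢t₂ = closeUp (edge⇒disjointRoutes e)
    where
    open Routes G
    open TwoConnectedRoutes G tc (ring C) t₁∈ t₂∈ t₁≢t₂
    open DisjointRoutes hiding (swap)

    closeUp : DisjointRoutes u v → Σ (Cycle G) λ C → EvenCycle C × EdgeInCycle u v C
    closeUp D with arcsBetween (adj-sym G′) C (end∈T (fromU D)) (end∈T (fromV D)) (ends-differ D)
    ... | α , β , odd with parity-choice _ _ odd (length (vertices (fromU D)) + length (tail (fromV D)))
    ...   | inj₁ even = cycleThroughArc (ring C) t₁∈ t₂∈ t₁≢t₂ D α even
    ...   | inj₂ even = cycleThroughArc (ring C) t₁∈ t₂∈ t₁≢t₂ D β even

corollary1 : (G : Graph) → TwoConnected G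
    → (∀ (u v : Vertex G) → adj G u v ≡ true → ¬ Bipartite (deleteEdge G u v))
    → ∀ (u v : Vertex G) → adj G u v ≡ true
    → Σ (Cycle G) λ C → EvenCycle C × EdgeInCycle u v C
corollary1 G tc nonBipartite u v e =
  evenCycleThroughEdge G tc e (oddCycleAfterDeletion G tc e (nonBipartite u v e))
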